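{- Let $G_1$ and $G_2$ be connected graphs, let $G=G_1\boxtimes G_2$ be their strong product, and let $g$ be a non-negative integer. Assume $G$ has at least one $g$-extra cut, and let $S$ be a $\kappa_g$-cut of $G$. For $x\in V(G_1)$ write ${}_xS=S\cap(\{x\}\times V(G_2))$, and for $y\in V(G_2)$ write $S_y=S\cap(V(G_1)\times\{y\})$. Then: (i) if ${}_xS\neq\emptyset$ for some $x\in V(G_1)$, then $|{}_xS|\geq \kappa(G_2)$; (ii) if $S_y\neq\emptyset$ for some $y\in V(G_2)$, then $|S_y|\geq \kappa(G_1)$.
   Context: The strong product $G_1\boxtimes G_2$ has vertex set $V(G_1)\times V(G_2)$, and two distinct vertices $(x_1,y_1),(x_2,y_2)$ are adjacent iff ($x_1=x_2$ or $x_1x_2\in E(G_1)$) and ($y_1=y_2$ or $y_1y_2\in E(G_2)$). For a graph $G$, $\kappa(G)$ is the minimum size of a vertex set whose deletion disconnects $G$ if $G$ is not complete, and $\kappa(G)=|V(G)|-1$ if $G$ is complete. For a non-negative integer $g$, a set $S\subseteq V(G)$ is a $g$-extra cut if $G-S$ is disconnected and every component of $G-S$ has at least $g+1$ vertices; the $g$-extra connectivity $\kappa_g(G)$ is the minimum size of a $g$-extra cut (and $\infty$ if none exists). A $\kappa_g$-cut is a $g$-extra cut of size $\kappa_g(G)$. -}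

module Defs where

open import Data.Nat using (ℕ; suc; _≤_; _∸_)
open import Data.Fin using (Fin)
open import Data.Fin.Properties using (_≟_)
open import Data.Product using (Σ; ∃; _×_; _,_; proj₁; proj₂)
open import Data.Sum using (_⊎_)
open import Data.List using (List; length; filter)
open import Data.List.Membership.Propositional using (_∈_; _∉_)
open import Data.List.Relation.Unary.All using (All)
open import Data.List.Relation.Unary.Unique.Propositional using (Unique)
open import Relation.Nullary using (¬_)
open import Relation.Binary.PropositionalEquality using (_≡_; _≢_)

record Graph (V : Set) : Set₁ where
  field
    _~_    : V → V → Set
    ~-sym  : ∀ {u v} → u ~ v → v ~ u
    ~-irr  : ∀ {u} → ¬ (u ~ u)
open Graph public

FinGraph : ℕ → Set₁
FinGraph n = Graph (Fin n)

record VSet (V : Set) : Set where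
  constructor vset
  field
    elems  : List V
    unique : Unique elems
open VSet public

∣_∣ : ∀ {V} → VSet V → ℕ
∣ S ∣ = length (elems S)

-- Walks in G - S (all vertices of the walk lie outside S).
data Reach {V : Set} (G : Graph V) (S : List V) : V → V → Set where
  here : ∀ {u} → u ∉ S → Reach G S u u
  step : ∀ {u v w} → u ∉ S → _~_ G u v → Reach G S v w → Reach G S u w

Connected : ∀ {V} → Graph V → Set
Connected G = ∀ u v → Reach G Data.List.[] u v

Disconnected- : ∀ {V} → Graph V → VSet V → Set
Disconnected- {V} G S =
  Σ V λ u → Σ V λ v → u ∉ elems S × v ∉ elems S × ¬ Reach G (elems S) u v

ComponentsAtLeast : ∀ {V} → Graph V → VSet V → ℕ → Set
ComponentsAtLeast {V} G S g =
  ∀ u → u ∉ elems S →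
    Σ (List V) λ L → Unique L × suc g ≤ length L × All (Reach G (elems S) u) L

IsExtraCut : ∀ {V} → Graph V → ℕ → VSet V → Set
IsExtraCut G g S = Disconnected- G S × ComponentsAtLeast G S g

HasExtraCut : ∀ {V} → Graph V → ℕ → Set
HasExtraCut {V} G g = Σ (VSet V) λ S → IsExtraCut G g S

IsKappaGCut : ∀ {V} → Graph V → ℕ → VSet V → Set
IsKappaGCut {V} G g S = IsExtraCut G g S × (∀ (T : VSet V) → IsExtraCut G g T → ∣ S ∣ ≤ ∣ T ∣)

Complete : ∀ {V} → Graph V → Set
Complete G = ∀ u v → u ≢ v → _~_ G u v

IsKappa : ∀ {n} → FinGraph n → ℕ → Set
IsKappa {n} G k =
  (Complete G × k ≡ n ∸ 1)
  ⊎ (¬ Complete G × Σ (VSet (Fin n)) (λ S → Disconnected- G S × ∣ S ∣ ≡ k)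
       × (∀ (T : VSet (Fin n)) → Disconnected- G T → k ≤ ∣ T ∣))

_⊠_ : ∀ {n₁ n₂} → FinGraph n₁ → FinGraph n₂ → Graph (Fin n₁ × Fin n₂)
G₁ ⊠ G₂ = record
  { _~_ = λ p q → p ≢ q × (proj₁ p ≡ proj₁ q ⊎ _~_ G₁ (proj₁ p) (proj₁ q))
                        × (proj₂ p ≡ proj₂ q ⊎ _~_ G₂ (proj₂ p) (proj₂ q))
  ; ~-sym = λ { (ne , a , b) → (λ e → ne (Relation.Binary.PropositionalEquality.sym e))
                              , Data.Sum.map Relation.Binary.PropositionalEquality.sym (~-sym G₁) a
                              , Data.Sum.map Relation.Binary.PropositionalEquality.sym (~-sym G₂) b }
  ; ~-irr = λ { (ne , _) → ne Relation.Binary.PropositionalEquality.refl }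
  }

fiber₁ : ∀ {n₁ n₂} → VSet (Fin n₁ × Fin n₂) → Fin n₁ → List (Fin n₁ × Fin n₂)
fiber₁ S x = filter (λ p → proj₁ p ≟ x) (elems S)

fiber₂ : ∀ {n₁ n₂} → VSet (Fin n₁ × Fin n₂) → Fin n₂ → List (Fin n₁ × Fin n₂)
fiber₂ S y = filter (λ p → proj₂ p ≟ y) (elems S)

module Submission where

-- Suppose (x, y) ∈ S but the column Y = {b | (x, b) ∈ S} has fewer than κ(G₂) vertices. Then G₂ − Y is
-- connected and Y contains no closed neighbourhood, so y has a neighbour y₀ ∉ Y, and every neighbour of
-- (x, y) outside S is joined to (x, y₀) in G − S: inside the layer {x} × G₂ directly, and from an adjacent
-- layer through some (x, z) with z ∉ Y. Hence S − (x, y) is still a g-extra cut, contradicting the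
-- minimality of S. Part (ii) is part (i) for the product with its factors swapped.

open import Defs
open import Data.Nat using (ℕ; _≤_; _<_; z≤n; s≤s)
open import Data.Nat.Properties using (≤-trans; ≤-<-trans; <-≤-trans; <⇒≱; ≰⇒>; m∸n≤m; _≤?_)
open import Data.Fin using (Fin)
open import Data.Fin.Properties using (all?; ¬∀⟶∃¬) renaming (_≟_ to _≟ᶠ_)
open import Data.Product using (Σ; _×_; _,_; proj₁; proj₂)
open import Data.Sum using (_⊎_; inj₁; inj₂)
open import Data.List using (List; []; _∷_; length; filter; map; allFin)
open import Data.List.Properties using (length-filter; filter-notAll; length-map; length-tabulate)
open import Data.List.Membership.Propositional using (_∈_; _∉_)
open import Data.List.Membership.Propositional.Properties using (∈-filter⁺; ∈-filter⁻; ∈-allFin; ∈-map⁻)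
open import Data.List.Relation.Binary.Subset.Propositional using (_⊆_)
open import Data.List.Relation.Unary.Any using (Any; here; there)
import Data.List.Relation.Unary.Any as Any
import Data.List.Relation.Unary.All as All
open import Data.List.Relation.Unary.AllPairs using (_∷_)
open import Data.List.Relation.Unary.Unique.Propositional using (Unique)
open import Data.List.Relation.Unary.Unique.Propositional.Properties using (filter⁺; allFin⁺; map⁺)
import Data.List.Membership.DecPropositional as DecMembership
open import Effect.Monad using (RawMonad)
open import Level using (0ℓ)
open import Relation.Nullary using (¬_; yes; no; ¬?)
open import Relation.Unary using (Decidable)
open import Relation.Nullary.Decidable using (decidable-stable)
open import Relation.Nullary.Negation using (¬¬-Monad; contradiction)
open import Relation.Binary.Definitions using (DecidableEquality)
open import Relation.Binary.PropositionalEquality using (_≡_; _≢_; refl; sym; trans; cong; cong₂; subst; subst₂)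

-- Adjacency is an arbitrary relation, so reachability is not decidable in general: connectivity facts
-- obtained from minimality of κ come double-negated, which suffices as the conclusion k ≤ |xS| is decidable.
open RawMonad (¬¬-Monad {a = 0ℓ}) using (pure; _>>=_; _<$>_)

module _ {A : Set} (_≟_ : DecidableEquality A) where

  unique-⊆⇒length-≤ : ∀ {xs ys : List A} → Unique xs → xs ⊆ ys → length xs ≤ length ys
  unique-⊆⇒length-≤ {[]} _ _ = z≤n
  unique-⊆⇒length-≤ {x ∷ xs} {ys} (x∉xs ∷ xs!) xs⊆ys =
    <-≤-trans (s≤s (unique-⊆⇒length-≤ xs! xs⊆ys∖x)) (filter-notAll ≢x? ys x∈ys)
    where
      ≢x? : Decidable (_≢ x)
      ≢x? z = ¬? (z ≟ x)
      x∈ys : Any (λ z → ¬ z ≢ x) ys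
      x∈ys = Any.map (λ { refl x≢x → x≢x refl }) (xs⊆ys (here refl))
      xs⊆ys∖x : xs ⊆ filter ≢x? ys
      xs⊆ys∖x z∈xs = ∈-filter⁺ ≢x? (xs⊆ys (there z∈xs)) (λ z≡x → All.lookup x∉xs z∈xs (sym z≡x))

  remove : VSet A → A → VSet A
  remove S a = vset (filter (λ z → ¬? (z ≟ a)) (elems S)) (filter⁺ (λ z → ¬? (z ≟ a)) (unique S))

  module _ {S : VSet A} {a : A} where

    ∣remove∣≤ : ∣ remove S a ∣ ≤ ∣ S ∣
    ∣remove∣≤ = length-filter (λ z → ¬? (z ≟ a)) (elems S)

    ∣remove∣< : a ∈ elems S → ∣ remove S a ∣ < ∣ S ∣
    ∣remove∣< a∈S = filter-notAll (λ z → ¬? (z ≟ a)) (elems S) (Any.map (λ { refl a≢a → a≢a refl }) a∈S)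

    ∈-remove⁺ : ∀ {z} → z ∈ elems S → z ≢ a → z ∈ elems (remove S a)
    ∈-remove⁺ = ∈-filter⁺ (λ z → ¬? (z ≟ a))

    ∉-remove⁺ : ∀ {z} → z ∉ elems S → z ∉ elems (remove S a)
    ∉-remove⁺ z∉S z∈S∖a = z∉S (proj₁ (∈-filter⁻ (λ z → ¬? (z ≟ a)) {xs = elems S} z∈S∖a))

    removed∉ : a ∉ elems (remove S a)
    removed∉ a∈S∖a = proj₂ (∈-filter⁻ (λ z → ¬? (z ≟ a)) {xs = elems S} a∈S∖a) refl

    ∉-remove⁻ : ∀ {z} → z ∉ elems (remove S a) → z ≡ a ⊎ z ∉ elems S
    ∉-remove⁻ {z} z∉S∖a with z ≟ a
    ... | yes z≡a = inj₁ z≡a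
    ... | no  z≢a = inj₂ (λ z∈S → z∉S∖a (∈-remove⁺ z∈S z≢a))

module _ {V : Set} {G : Graph V} where

  Reach-source∉ : ∀ {S u v} → Reach G S u v → u ∉ S
  Reach-source∉ (here u∉S)     = u∉S
  Reach-source∉ (step u∉S _ _) = u∉S

  Reach-snoc : ∀ {S u v w} → Reach G S u v → _~_ G v w → w ∉ S → Reach G S u w
  Reach-snoc (here v∉S)      v~w w∉S = step v∉S v~w (here w∉S)
  Reach-snoc (step u∉S u~ r) v~w w∉S = step u∉S u~ (Reach-snoc r v~w w∉S)

  Reach-trans : ∀ {S u v w} → Reach G S u v → Reach G S v w → Reach G S u w
  Reach-trans (here _)        r′ = r′
  Reach-trans (step u∉S u~ r) r′ = step u∉S u~ (Reach-trans r r′)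

  Reach-sym : ∀ {S u v} → Reach G S u v → Reach G S v u
  Reach-sym (here u∉S)       = here u∉S
  Reach-sym (step u∉S u~w r) = Reach-snoc (Reach-sym r) (~-sym G u~w) u∉S

  Reach-mono : ∀ {S T} → (∀ {z} → z ∉ S → z ∉ T) → ∀ {u v} → Reach G S u v → Reach G T u v
  Reach-mono T⊆S (here u∉S)      = here (T⊆S u∉S)
  Reach-mono T⊆S (step u∉S u~ r) = step (T⊆S u∉S) u~ (Reach-mono T⊆S r)

Near : ∀ {V} → Graph V → V → V → Set
Near G a b = a ≡ b ⊎ _~_ G a b

Near-sym : ∀ {V} {G : Graph V} {a b} → Near G a b → Near G b a
Near-sym         (inj₁ a≡b) = inj₁ (sym a≡b)
Near-sym {G = G} (inj₂ a~b) = inj₂ (~-sym G a~b)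

module _ {n} {H : FinGraph n} where

  open DecMembership (_≟ᶠ_ {n}) using (_∈?_)

  complete-connects : Complete H → ∀ {T u v} → u ∉ T → v ∉ T → Reach H T u v
  complete-connects complete {u = u} {v} u∉T v∉T with u ≟ᶠ v
  ... | yes refl = here u∉T
  ... | no  u≢v  = step u∉T (complete u v u≢v) (here v∉T)

  κ≤separator : ∀ {k} → IsKappa H k → ∀ T → Disconnected- H T → k ≤ ∣ T ∣
  κ≤separator (inj₁ (complete , _)) _ (_ , _ , u∉T , v∉T , ¬reach) =
    contradiction (complete-connects complete u∉T v∉T) ¬reach
  κ≤separator (inj₂ (_ , _ , minimal)) = minimal

  κ≤order : ∀ {k} → IsKappa H k → k ≤ n
  κ≤order (inj₁ (_ , refl))               = m∸n≤m n 1
  κ≤order (inj₂ (_ , (T , _ , refl) , _)) =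
    subst (∣ T ∣ ≤_) (length-tabulate (λ i → i)) (unique-⊆⇒length-≤ _≟ᶠ_ (unique T) (λ {z} _ → ∈-allFin z))

  module _ {k} (κ : IsKappa H k) (Y : VSet (Fin n)) (∣Y∣<k : ∣ Y ∣ < k) where

    small-cut-connects : ∀ {a b} → a ∉ elems Y → b ∉ elems Y → ¬ ¬ Reach H (elems Y) a b
    small-cut-connects a∉Y b∉Y ¬reach = <⇒≱ ∣Y∣<k (κ≤separator κ Y (_ , _ , a∉Y , b∉Y , ¬reach))

    small-∌-closedNeighbourhood : ∀ z → ¬ (∀ w → Near H z w → w ∈ elems Y)
    small-∌-closedNeighbourhood z N[z]⊆Y with all? (λ w → w ∈? elems Y)
    ... | yes V⊆Y = <⇒≱ ∣Y∣<k (≤-trans (κ≤order κ) n≤∣Y∣)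
      where
        n≤∣Y∣ : n ≤ ∣ Y ∣
        n≤∣Y∣ = subst (_≤ ∣ Y ∣) (length-tabulate (λ i → i)) (unique-⊆⇒length-≤ _≟ᶠ_ (allFin⁺ n) (λ {w} _ → V⊆Y w))
    ... | no  V⊈Y with ¬∀⟶∃¬ n _ (λ w → w ∈? elems Y) V⊈Y
    ...   | w , w∉Y = <⇒≱ ∣Y∣<k (≤-trans (κ≤separator κ (remove _≟ᶠ_ Y z) separates) (∣remove∣≤ _≟ᶠ_ {Y}))
      where
        -- Y − z separates z from w, because every neighbour of z lies in Y.
        cut-off : ¬ Reach H (elems (remove _≟ᶠ_ Y z)) z w
        cut-off (here _)               = w∉Y (N[z]⊆Y w (inj₁ refl))
        cut-off (step {v = v} _ z~v r) =
          Reach-source∉ r (∈-remove⁺ _≟ᶠ_ {Y} (N[z]⊆Y v (inj₂ z~v)) (λ v≡z → ~-irr H (subst (_~_ H z) v≡z z~v)))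
        separates : Disconnected- H (remove _≟ᶠ_ Y z)
        separates = z , w , removed∉ _≟ᶠ_ {Y} , ∉-remove⁺ _≟ᶠ_ {Y} w∉Y , cut-off

    small-misses-closedNeighbourhood : ∀ z → ¬ ¬ Σ (Fin n) λ w → Near H z w × w ∉ elems Y
    small-misses-closedNeighbourhood z ¬miss =
      small-∌-closedNeighbourhood z λ w z≈w → decidable-stable (w ∈? elems Y) (λ w∉Y → ¬miss (w , z≈w , w∉Y))

-- Putting s back only enlarges the component of c.
removal-preserves-extraCut :
  ∀ {V} {G : Graph V} (_≟_ : DecidableEquality V) {g S s c} →
  IsExtraCut G g S → s ∈ elems S → c ∉ elems S → _~_ G s c →
  (∀ q → q ∉ elems S → _~_ G s q → ¬ ¬ Reach G (elems S) c q) →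
  IsExtraCut G g (remove _≟_ S s)
removal-preserves-extraCut {G = G} _≟_ {g} {S} {s} {c}
  ((u , v , u∉S , v∉S , ¬reach) , large) s∈S c∉S s~c c⇝neighbour =
    (u , v , ∉S⁺ u∉S , ∉S⁺ v∉S , λ r → proj₁ (reroute r v∉S) u∉S ¬reach) , large′
  where
    S′ = elems (remove _≟_ S s)

    ∉S⁺ : ∀ {z} → z ∉ elems S → z ∉ S′
    ∉S⁺ = ∉-remove⁺ _≟_ {S}

    reroute : ∀ {u v} → Reach G S′ u v → v ∉ elems S →
              (u ∉ elems S → ¬ ¬ Reach G (elems S) u v) × (u ≡ s → ¬ ¬ Reach G (elems S) c v)
    reroute (here _) v∉S = (λ _ → pure (here v∉S)) , λ { refl → contradiction s∈S v∉S }
    reroute (step _ u~w r) v∉S with reroute r v∉S | ∉-remove⁻ _≟_ {S} (Reach-source∉ r)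
    ... | _ , c⇝v | inj₁ refl =
          (λ u∉S → do c⇝u ← c⇝neighbour _ u∉S (~-sym G u~w)
                      Reach-trans (Reach-sym c⇝u) <$> c⇝v refl)
        , λ { refl → contradiction u~w (~-irr G) }
    ... | w⇝v , _ | inj₂ w∉S =
          (λ u∉S → step u∉S u~w <$> w⇝v w∉S)
        , λ { refl → do c⇝w ← c⇝neighbour _ w∉S u~w
                        Reach-trans c⇝w <$> w⇝v w∉S }

    large′ : ComponentsAtLeast G (remove _≟_ S s) g
    large′ z z∉S′ with ∉-remove⁻ _≟_ {S} z∉S′
    ... | inj₂ z∉S = let L , L! , size , z⇝L = large z z∉S
                     in L , L! , size , All.map (Reach-mono ∉S⁺) z⇝L
    ... | inj₁ refl = let L , L! , size , c⇝L = large c c∉S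
                      in L , L! , size , All.map (λ c⇝ → step (removed∉ _≟_ {S}) s~c (Reach-mono ∉S⁺ c⇝)) c⇝L

-- Abstracting over the coordinates lets part (ii) be proved as part (i) of the swapped product.
record IsStrongProduct {V : Set} {n₁ n₂} (G : Graph V) (G₁ : FinGraph n₁) (G₂ : FinGraph n₂) : Set where
  field
    pair         : Fin n₁ → Fin n₂ → V
    fst          : V → Fin n₁
    snd          : V → Fin n₂
    fst-pair     : ∀ a b → fst (pair a b) ≡ a
    snd-pair     : ∀ a b → snd (pair a b) ≡ b
    pair-fst-snd : ∀ v → pair (fst v) (snd v) ≡ v
    ~⇒           : ∀ {v w} → _~_ G v w → Near G₁ (fst v) (fst w) × Near G₂ (snd v) (snd w)
    ~⇐           : ∀ {v w} → v ≢ w → Near G₁ (fst v) (fst w) → Near G₂ (snd v) (snd w) → _~_ G v w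

⊠-isStrongProduct : ∀ {n₁ n₂} (G₁ : FinGraph n₁) (G₂ : FinGraph n₂) → IsStrongProduct (G₁ ⊠ G₂) G₁ G₂
⊠-isStrongProduct G₁ G₂ = record
  { pair = _,_ ; fst = proj₁ ; snd = proj₂
  ; fst-pair = λ _ _ → refl ; snd-pair = λ _ _ → refl ; pair-fst-snd = λ _ → refl
  ; ~⇒ = proj₂ ; ~⇐ = λ v≢w near₁ near₂ → v≢w , near₁ , near₂
  }

⊠-isStrongProduct-swap : ∀ {n₁ n₂} (G₁ : FinGraph n₁) (G₂ : FinGraph n₂) → IsStrongProduct (G₁ ⊠ G₂) G₂ G₁
⊠-isStrongProduct-swap G₁ G₂ = record
  { pair = λ b a → a , b ; fst = proj₂ ; snd = proj₁
  ; fst-pair = λ _ _ → refl ; snd-pair = λ _ _ → refl ; pair-fst-snd = λ _ → refl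
  ; ~⇒ = λ (_ , near₁ , near₂) → near₂ , near₁ ; ~⇐ = λ v≢w near₂ near₁ → v≢w , near₁ , near₂
  }

module StrongProduct {V : Set} {n₁ n₂} {G : Graph V} {G₁ : FinGraph n₁} {G₂ : FinGraph n₂}
                     (P : IsStrongProduct G G₁ G₂) where

  open IsStrongProduct P

  _≟_ : DecidableEquality V
  v ≟ w with fst v ≟ᶠ fst w | snd v ≟ᶠ snd w
  ... | yes fst≡ | yes snd≡ = yes (trans (sym (pair-fst-snd v)) (trans (cong₂ pair fst≡ snd≡) (pair-fst-snd w)))
  ... | no  fst≢ | _        = no (λ v≡w → fst≢ (cong fst v≡w))
  ... | yes _    | no snd≢  = no (λ v≡w → snd≢ (cong snd v≡w))

  open DecMembership _≟_ using (_∈?_)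

  pair-injectiveʳ : ∀ {x b b′} → pair x b ≡ pair x b′ → b ≡ b′
  pair-injectiveʳ {x} {b} {b′} eq = trans (sym (snd-pair x b)) (trans (cong snd eq) (snd-pair x b′))

  pair-~ʳ : ∀ {x a b} → _~_ G₂ a b → _~_ G (pair x a) (pair x b)
  pair-~ʳ {x} {a} {b} a~b =
    ~⇐ (λ eq → ~-irr G₂ (subst (_~_ G₂ a) (sym (pair-injectiveʳ eq)) a~b))
       (inj₁ (trans (fst-pair x a) (sym (fst-pair x b))))
       (inj₂ (subst₂ (_~_ G₂) (sym (snd-pair x a)) (sym (snd-pair x b)) a~b))

  fibre : VSet V → Fin n₁ → List V
  fibre S x = filter (λ p → fst p ≟ᶠ x) (elems S)

  column : VSet V → Fin n₁ → VSet (Fin n₂)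
  column S x = vset (filter (λ b → pair x b ∈? elems S) (allFin n₂)) (filter⁺ (λ b → pair x b ∈? elems S) (allFin⁺ n₂))

  module _ {S : VSet V} {x : Fin n₁} where

    ∈-column⁺ : ∀ {b} → pair x b ∈ elems S → b ∈ elems (column S x)
    ∈-column⁺ {b} = ∈-filter⁺ (λ b → pair x b ∈? elems S) (∈-allFin b)

    ∈-column⁻ : ∀ {b} → b ∈ elems (column S x) → pair x b ∈ elems S
    ∈-column⁻ b∈ = proj₂ (∈-filter⁻ (λ b → pair x b ∈? elems S) {xs = allFin n₂} b∈)

    ∣column∣≤∣fibre∣ : ∣ column S x ∣ ≤ length (fibre S x)
    ∣column∣≤∣fibre∣ =
      subst (_≤ length (fibre S x)) (length-map (pair x) (elems (column S x)))
        (unique-⊆⇒length-≤ _≟_ (map⁺ pair-injectiveʳ (unique (column S x))) pairs⊆fibre)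
      where
        pairs⊆fibre : map (pair x) (elems (column S x)) ⊆ fibre S x
        pairs⊆fibre p∈ with ∈-map⁻ (pair x) p∈
        ... | b , b∈ , refl = ∈-filter⁺ (λ p → fst p ≟ᶠ x) (∈-column⁻ b∈) (fst-pair x b)

    Reach-lift : ∀ {a b} → Reach G₂ (elems (column S x)) a b → Reach G (elems S) (pair x a) (pair x b)
    Reach-lift (here a∉)      = here (λ pair∈ → a∉ (∈-column⁺ pair∈))
    Reach-lift (step a∉ a~ r) = step (λ pair∈ → a∉ (∈-column⁺ pair∈)) (pair-~ʳ a~) (Reach-lift r)

    module _ {k} (κ : IsKappa G₂ k) (∣column∣<k : ∣ column S x ∣ < k) where

      column-connects : ∀ {a b} → a ∉ elems (column S x) → b ∉ elems (column S x) →
                        ¬ ¬ Reach G (elems S) (pair x a) (pair x b)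
      column-connects a∉ b∉ = Reach-lift <$> small-cut-connects κ (column S x) ∣column∣<k a∉ b∉

      neighbours-connected : ∀ {y y₀} → y₀ ∉ elems (column S x) →
        ∀ q → q ∉ elems S → _~_ G (pair x y) q → ¬ ¬ Reach G (elems S) (pair x y₀) q
      neighbours-connected {y} {y₀} y₀∉ q q∉S s~q with proj₁ (~⇒ s~q)
      ... | inj₁ fst≡ = subst (Reach G (elems S) (pair x y₀)) pair≡q <$> column-connects y₀∉ snd-q∉
        where
          pair≡q : pair x (snd q) ≡ q
          pair≡q = trans (cong (λ a → pair a (snd q)) (trans (sym (fst-pair x y)) fst≡)) (pair-fst-snd q)
          snd-q∉ : snd q ∉ elems (column S x)
          snd-q∉ q∈ = q∉S (subst (_∈ elems S) pair≡q (∈-column⁻ q∈))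
      ... | inj₂ fst~ = do
            z , q≈z , z∉ ← small-misses-closedNeighbourhood κ (column S x) ∣column∣<k (snd q)
            y₀⇝z ← column-connects y₀∉ z∉
            pure (Reach-snoc y₀⇝z (pair~q z q≈z) q∉S)
        where
          x~fst-q : _~_ G₁ x (fst q)
          x~fst-q = subst (λ a → _~_ G₁ a (fst q)) (fst-pair x y) fst~
          pair~q : ∀ z → Near G₂ (snd q) z → _~_ G (pair x z) q
          pair~q z q≈z =
            ~⇐ (λ eq → ~-irr G₁ (subst (λ a → _~_ G₁ a (fst q)) (trans (sym (fst-pair x z)) (cong fst eq)) x~fst-q))
               (inj₂ (subst (λ a → _~_ G₁ a (fst q)) (sym (fst-pair x z)) x~fst-q))
               (subst (λ b → Near G₂ b (snd q)) (sym (snd-pair x z)) (Near-sym {G = G₂} q≈z))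

  kappaCut-fibre-≥κ : ∀ {g S x y k} → IsKappaGCut G g S → pair x y ∈ elems S → IsKappa G₂ k →
                      k ≤ length (fibre S x)
  kappaCut-fibre-≥κ {g} {S} {x} {y} {k} (cut , minimal) s∈S κ =
    decidable-stable (k ≤? length (fibre S x)) λ k≰ →
      let ∣column∣<k = ≤-<-trans (∣column∣≤∣fibre∣ {S} {x}) (≰⇒> k≰)
      in small-misses-closedNeighbourhood κ (column S x) ∣column∣<k y λ (y₀ , y≈y₀ , y₀∉) →
           removal-not-extraCut
             (removal-preserves-extraCut _≟_ {S = S} cut s∈S (λ c∈ → y₀∉ (∈-column⁺ {S} {x} c∈)) (s~c y≈y₀ y₀∉)
                                         (neighbours-connected {S} {x} κ ∣column∣<k y₀∉))
    where
      removal-not-extraCut : ¬ IsExtraCut G g (remove _≟_ S (pair x y))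
      removal-not-extraCut cut′ = <⇒≱ (∣remove∣< _≟_ {S} s∈S) (minimal (remove _≟_ S (pair x y)) cut′)
      s~c : ∀ {y₀} → Near G₂ y y₀ → y₀ ∉ elems (column S x) → _~_ G (pair x y) (pair x y₀)
      s~c (inj₁ refl) y∉ = contradiction (∈-column⁺ {S} {x} s∈S) y∉
      s~c (inj₂ y~y₀) _  = pair-~ʳ y~y₀

lemma2p1 : ∀ {n₁ n₂} (G₁ : FinGraph n₁) (G₂ : FinGraph n₂) (g : ℕ) →
    Connected G₁ → Connected G₂ →
    HasExtraCut (G₁ ⊠ G₂) g →
    (S : VSet (Fin n₁ × Fin n₂)) → IsKappaGCut (G₁ ⊠ G₂) g S →
    (∀ (x : Fin n₁) → (Σ (Fin n₂) λ y → (x , y) ∈ elems S) →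
       ∀ k → IsKappa G₂ k → k ≤ length (fiber₁ S x))
    × (∀ (y : Fin n₂) → (Σ (Fin n₁) λ x → (x , y) ∈ elems S) →
       ∀ k → IsKappa G₁ k → k ≤ length (fiber₂ S y))
lemma2p1 G₁ G₂ _ _ _ _ S κ-cut =
    (λ x (y , s∈S) _ κ → StrongProduct.kappaCut-fibre-≥κ (⊠-isStrongProduct G₁ G₂) {S = S} {x} κ-cut s∈S κ)
  , (λ y (x , s∈S) _ κ → StrongProduct.kappaCut-fibre-≥κ (⊠-isStrongProduct-swap G₁ G₂) {S = S} {y} κ-cut s∈S κ)
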